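{- Let $G$ be a finite, simple, connected graph with no induced house and no induced hole, and let $u,v$ and $x,y$ be two good pairs with $\overline{uv}=\overline{xy}$. If the pairs $uv$ and $xy$ are $\gamma$-related, then $\{u,v,x,y\}$ is a $C_4$-module of $G$.
   Context: The house is a 5-cycle plus one chord; a hole is a cycle on at least five vertices. $d_G$ is the shortest-path distance. A vertex $z$ is between $a$ and $b$ if $d_G(a,b)=d_G(a,z)+d_G(z,b)$; $I(a,b)$ is the set of such vertices. For distinct $a,b$, the line $\overline{ab}$ is the set of all $z$ such that one of $a,b,z$ is between the other two. A good pair is a pair $u,v$ with $d_G(u,v)=2$ having a common neighbour $c$ with $\overline{uc}=\overline{cv}$. A sequence $(a,b,c,d)$ of four distinct vertices is a parallelogram if $b\in I(a,c)$, $c\in I(b,d)$, $d\in I(c,a)$ and $a\in I(d,b)$. Pairs $uv$ and $xy$ are $\gamma$-related if $(u,x,v,y)$ is a parallelogram and $\overline{uv}=I(u,v)=I(x,y)=\overline{xy}$. A $C_4$-module is a set of four vertices inducing a 4-cycle such that every other vertex of $G$ is adjacent to all four or to none of them. -}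

module Defs where

open import Data.Nat using (ℕ; zero; suc; _+_; _≤_)
open import Data.Fin using (Fin; toℕ)
open import Data.Bool using (Bool; T)
open import Data.Product using (Σ; ∃; ∃-syntax; _×_; _,_)
open import Data.Sum using (_⊎_)
open import Relation.Nullary using (¬_)
open import Relation.Binary.PropositionalEquality using (_≡_; _≢_)
open import Function.Definitions using (Injective)
open import Function.Bundles using (_⇔_)

record Graph : Set where
  field
    n      : ℕ
    adj    : Fin n → Fin n → Bool
    sym    : ∀ a b → T (adj a b) → T (adj b a)
    irrefl : ∀ a → ¬ T (adj a a)

module _ (G : Graph) where
  open Graph G

  V : Set
  V = Fin n

  Adj : V → V → Set
  Adj a b = T (adj a b)

  data Walk : V → V → ℕ → Set where
    nil  : ∀ {a} → Walk a a zero
    cons : ∀ {a c b k} → Adj a c → Walk c b k → Walk a b (suc k)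

  Connected : Set
  Connected = ∀ a b → ∃[ k ] Walk a b k

  Dist : V → V → ℕ → Set
  Dist a b k = Walk a b k × (∀ m → Walk a b m → k ≤ m)

  Between : V → V → V → Set
  Between a b z = ∃[ k₁ ] ∃[ k₂ ] (Dist a z k₁ × Dist z b k₂ × Dist a b (k₁ + k₂))

  Line : V → V → V → Set
  Line a b z = Between a b z ⊎ Between z b a ⊎ Between a z b

  SameSet : (V → Set) → (V → Set) → Set
  SameSet P Q = ∀ z → P z ⇔ Q z

  GoodPair : V → V → Set
  GoodPair u v = Dist u v 2 × ∃[ c ] (Adj u c × Adj c v × SameSet (Line u c) (Line c v))

  Parallelogram : V → V → V → V → Set
  Parallelogram a b c d =
    a ≢ b × a ≢ c × a ≢ d × b ≢ c × b ≢ d × c ≢ d ×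
    Between a c b × Between b d c × Between c a d × Between d b a

  γRelated : V → V → V → V → Set
  γRelated u v x y =
    Parallelogram u x v y ×
    SameSet (Line u v) (Between u v) ×
    SameSet (Between u v) (Between x y) ×
    SameSet (Between x y) (Line x y)

  InducedCopy : (m : ℕ) → (Fin m → Fin m → Set) → (Fin m → V) → Set
  InducedCopy m H f = Injective _≡_ _≡_ f × (∀ i j → Adj (f i) (f j) ⇔ H i j)

CycAdj : (m : ℕ) → Fin m → Fin m → Set
CycAdj m i j =
  suc (toℕ i) ≡ toℕ j ⊎ suc (toℕ j) ≡ toℕ i ⊎
  (toℕ i ≡ 0 × suc (toℕ j) ≡ m) ⊎ (toℕ j ≡ 0 × suc (toℕ i) ≡ m)

HouseAdj : Fin 5 → Fin 5 → Set
HouseAdj i j = CycAdj 5 i j ⊎ (toℕ i ≡ 0 × toℕ j ≡ 2) ⊎ (toℕ i ≡ 2 × toℕ j ≡ 0)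

module _ (G : Graph) where

  HasInducedHouse : Set
  HasInducedHouse = ∃[ f ] InducedCopy G 5 HouseAdj f

  HasInducedHole : Set
  HasInducedHole = ∃[ m ] (5 ≤ m × ∃[ f ] InducedCopy G m (CycAdj m) f)

  C4Module : (V G → Set) → Set
  C4Module S =
    (∃[ f ] (InducedCopy G 4 (CycAdj 4) f × (∀ i → S (f i)) × (∀ z → S z → ∃[ i ] f i ≡ z))) ×
    (∀ w → ¬ S w → (∀ s → S s → Adj G w s) ⊎ (∀ s → S s → ¬ Adj G w s))

  Four : V G → V G → V G → V G → V G → Set
  Four u v x y z = z ≡ u ⊎ z ≡ v ⊎ z ≡ x ⊎ z ≡ y

module Submission where

-- 1. Metric facts about shortest-path distance: it is unique and
--    symmetric, a vertex between two vertices at distance 2 is a common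
--    neighbour of them (and conversely), and no vertex of a triangle lies
--    on the line through the other two.
-- 2. Twin lemma: if (a,b) is a good pair whose line is contained in its
--    interval I(a,b), then every vertex other than a and b sees a iff it
--    sees b.  The γ-relation gives exactly this containment for uv and xy.
-- 3. The parallelogram (u,x,v,y) with d(u,v) = d(x,y) = 2 is an induced
--    square u-x-v-y, hence an induced C₄.
-- 4. Module property: a vertex w outside the square that sees u sees v
--    (twins), so w ∈ I(u,v) = I(x,y) and w sees x and y; symmetrically a
--    vertex seeing x or y sees u.  So w sees all four corners or none.

open import Defs
open import Data.Nat using (ℕ; zero; suc; _+_; _≤_; z≤n; s≤s; _≟_)
open import Data.Nat.Properties using (≤-antisym; +-comm; m≤m+n)
open import Data.Fin using (Fin; zero; suc; toℕ)
open import Data.Product using (∃; _×_; _,_; proj₁; proj₂)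
open import Data.Sum using (_⊎_; inj₁; inj₂; [_,_]′)
open import Data.Empty using (⊥-elim)
open import Function using (_∘_)
open import Relation.Nullary using (¬_; Dec)
open import Relation.Nullary.Decidable
  using (T?; True; False; toWitness; toWitnessFalse; toSum; decidable-stable; _×-dec_; _⊎-dec_)
open import Relation.Binary.PropositionalEquality using (_≡_; _≢_; refl; sym; subst)
open import Function.Bundles using (_⇔_; mk⇔; Equivalence)

-- Adjacency of the cycle C_m is decidable; this lets the edge table of C₄
-- be read off by computation.
cycAdj? : ∀ m i j → Dec (CycAdj m i j)
cycAdj? m i j =
  (suc (toℕ i) ≟ toℕ j) ⊎-dec (suc (toℕ j) ≟ toℕ i) ⊎-dec
  ((toℕ i ≟ 0) ×-dec (suc (toℕ j) ≟ m)) ⊎-dec ((toℕ j ≟ 0) ×-dec (suc (toℕ i) ≟ m))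

module _ (G : Graph) where
  open Graph G using (adj; irrefl) renaming (sym to adj-sym)

  private
    variable
      a b c d p q r u v x y w z : V G
      k m : ℕ

  adj-symmetric : Adj G a b → Adj G b a
  adj-symmetric = adj-sym _ _

  adj⇒≢ : Adj G a b → a ≢ b
  adj⇒≢ {a} a~b refl = irrefl a a~b

  walk-zero : Walk G a b 0 → a ≡ b
  walk-zero nil = refl

  walk-one : Walk G a b 1 → Adj G a b
  walk-one (cons a~b nil) = a~b

  _▹_ : Walk G a b k → Adj G b c → Walk G a c (suc k)
  nil ▹ e = cons e nil
  cons e′ walk ▹ e = cons e′ (walk ▹ e)

  reverse : Walk G a b k → Walk G b a k
  reverse nil = nil
  reverse (cons e walk) = reverse walk ▹ adj-symmetric e

  dist-unique : Dist G a b k → Dist G a b m → k ≡ m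
  dist-unique (walk-k , min-k) (walk-m , min-m) = ≤-antisym (min-k _ walk-m) (min-m _ walk-k)

  dist-sym : Dist G a b k → Dist G b a k
  dist-sym (walk , min) = reverse walk , λ m walk′ → min m (reverse walk′)

  adj⇒dist : Adj G a b → Dist G a b 1
  adj⇒dist {a} {b} a~b = cons a~b nil , at-least-one
    where
    at-least-one : ∀ m → Walk G a b m → 1 ≤ m
    at-least-one zero walk = ⊥-elim (adj⇒≢ a~b (walk-zero walk))
    at-least-one (suc m) _ = s≤s z≤n

  dist⇒adj : Dist G a b 1 → Adj G a b
  dist⇒adj = walk-one ∘ proj₁

  common-neighbour⇒dist : a ≢ b → ¬ Adj G a b → Adj G a c → Adj G c b → Dist G a b 2
  common-neighbour⇒dist {a} {b} a≢b a≁b a~c c~b = cons a~c (cons c~b nil) , at-least-two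
    where
    at-least-two : ∀ m → Walk G a b m → 2 ≤ m
    at-least-two zero walk = ⊥-elim (a≢b (walk-zero walk))
    at-least-two (suc zero) walk = ⊥-elim (a≁b (walk-one walk))
    at-least-two (suc (suc m)) _ = s≤s (s≤s z≤n)

  dist2⇒≢ : Dist G a b 2 → a ≢ b
  dist2⇒≢ (_ , min) refl with min 0 nil
  ... | ()

  dist2⇒¬adj : Dist G a b 2 → ¬ Adj G a b
  dist2⇒¬adj (_ , min) a~b with min 1 (cons a~b nil)
  ... | s≤s ()

  between-sym : Between G a b z → Between G b a z
  between-sym (k₁ , k₂ , az , zb , ab) =
    k₂ , k₁ , dist-sym zb , dist-sym az , subst (Dist G _ _) (+-comm k₁ k₂) (dist-sym ab)

  between-dist : Between G a b z → Dist G a z k → Dist G z b m → Dist G a b (k + m)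
  between-dist (k₁ , k₂ , az , zb , ab) az′ zb′
    rewrite dist-unique az′ az | dist-unique zb′ zb = ab

  between⇒≤ : Between G a b z → Dist G a b k → Dist G a z m → m ≤ k
  between⇒≤ (k₁ , k₂ , az , zb , ab) ab′ az′
    rewrite dist-unique ab′ ab | dist-unique az′ az = m≤m+n k₁ k₂

  common-neighbour⇒between : Dist G a b 2 → Adj G a z → Adj G z b → Between G a b z
  common-neighbour⇒between ab a~z z~b = 1 , 1 , adj⇒dist a~z , adj⇒dist z~b , ab

  between⇒common-neighbour : Dist G a b 2 → Between G a b z → a ≢ z → z ≢ b →
                             Adj G a z × Adj G z b
  between⇒common-neighbour ab (k₁ , k₂ , az , zb , ab′) =
    split k₁ k₂ az zb (dist-unique ab′ ab)
    where
    split : ∀ k₁ k₂ → Dist G a z k₁ → Dist G z b k₂ → k₁ + k₂ ≡ 2 → a ≢ z → z ≢ b →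
            Adj G a z × Adj G z b
    split zero _ az _ _ a≢z _ = ⊥-elim (a≢z (walk-zero (proj₁ az)))
    split _ zero _ zb _ _ z≢b = ⊥-elim (z≢b (walk-zero (proj₁ zb)))
    split 1 1 az zb _ _ _ = dist⇒adj az , dist⇒adj zb
    split 1 (suc (suc _)) _ _ () _ _
    split 2 (suc _) _ _ () _ _
    split (suc (suc (suc _))) (suc _) _ _ () _ _

  triangle-not-between : Adj G p q → Adj G q r → Adj G p r → ¬ Between G p r q
  triangle-not-between p~q q~r p~r pqr
    with dist-unique (between-dist pqr (adj⇒dist p~q) (adj⇒dist q~r)) (adj⇒dist p~r)
  ... | ()

  triangle-not-on-line : Adj G p q → Adj G q r → Adj G p r → ¬ Line G p r q
  triangle-not-on-line p~q q~r p~r (inj₁ pqr) = triangle-not-between p~q q~r p~r pqr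
  triangle-not-on-line p~q q~r p~r (inj₂ (inj₁ qpr)) =
    triangle-not-between (adj-symmetric p~q) p~r q~r qpr
  triangle-not-on-line p~q q~r p~r (inj₂ (inj₂ prq)) =
    triangle-not-between p~r (adj-symmetric q~r) p~q prq

  line-sym : Line G a b z → Line G b a z
  line-sym (inj₁ azb) = inj₁ (between-sym azb)
  line-sym (inj₂ (inj₁ zab)) = inj₂ (inj₂ (between-sym zab))
  line-sym (inj₂ (inj₂ abz)) = inj₂ (inj₁ (between-sym abz))

  LineInInterval : V G → V G → Set
  LineInInterval a b = ∀ z → Line G a b z → Between G a b z

  line-in-interval-sym : LineInInterval a b → LineInInterval b a
  line-in-interval-sym line⊆I z = between-sym ∘ line⊆I z ∘ line-sym

  good-pair-sym : GoodPair G a b → GoodPair G b a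
  good-pair-sym (ab , c , a~c , c~b , lines) =
    dist-sym ab , c , adj-symmetric c~b , adj-symmetric a~c ,
    λ z → mk⇔ (line-sym ∘ Equivalence.from (lines z) ∘ line-sym)
              (line-sym ∘ Equivalence.to (lines z) ∘ line-sym)

  -- If w saw c, then c ∈ I(w,b) would put w on the
  -- line cb = ac, which is impossible for the triangle a,c,w.
  twin-centre-adjacent : Adj G a c → Adj G c b → SameSet G (Line G a c) (Line G c b) →
                         w ≢ b → Adj G w a → ¬ Adj G w b → ¬ Adj G w c
  twin-centre-adjacent {c = c} {b = b} {w = w} a~c c~b lines w≢b w~a w≁b w~c =
    triangle-not-on-line (adj-symmetric w~a) w~c a~c (Equivalence.from (lines w) (inj₂ (inj₁ c∈I[w,b])))
    where
    c∈I[w,b] : Between G w b c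
    c∈I[w,b] = common-neighbour⇒between (common-neighbour⇒dist w≢b w≁b w~c c~b) w~c c~b

  -- If w sees neither b nor c, then a ∈ I(w,c)
  -- puts w on the line ac = cb.  Each of the three ways of lying on cb
  -- fails: d(c,w) = 2 exceeds d(c,b); d(w,b) = 3 would put w on the line ab
  -- but outside I(a,b); and b ∈ I(c,w) would make b a neighbour of w.
  twin-centre-far : Dist G a b 2 → Adj G a c → Adj G c b → SameSet G (Line G a c) (Line G c b) →
                    LineInInterval a b → w ≢ b → Adj G w a → ¬ Adj G w b → ¬ ¬ Adj G w c
  twin-centre-far {a} {b} {c} {w} ab a~c c~b lines line⊆I w≢b w~a w≁b w≁c =
    not-on-cb (Equivalence.to (lines w) (inj₂ (inj₁ (common-neighbour⇒between wc w~a a~c))))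
    where
    w≢c : w ≢ c
    w≢c refl = w≁b c~b

    wc : Dist G w c 2
    wc = common-neighbour⇒dist w≢c w≁c w~a a~c

    not-at-distance-3 : ¬ Dist G w b 3
    not-at-distance-3 wb
      with between⇒≤ (between-sym (line⊆I w (inj₂ (inj₁ (1 , 2 , adj⇒dist w~a , ab , wb)))))
                     (dist-sym ab) (dist-sym wb)
    ... | s≤s (s≤s ())

    not-on-cb : ¬ Line G c b w
    not-on-cb (inj₁ cwb) with between⇒≤ cwb (adj⇒dist c~b) (dist-sym wc)
    ... | s≤s ()
    not-on-cb (inj₂ (inj₁ wcb)) = not-at-distance-3 (between-dist wcb wc (adj⇒dist c~b))
    not-on-cb (inj₂ (inj₂ cbw)) =
      w≁b (adj-symmetric (proj₂ (between⇒common-neighbour (dist-sym wc) cbw (adj⇒≢ c~b) (w≢b ∘ sym))))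

  good-pair-twin : GoodPair G a b → LineInInterval a b → w ≢ b → Adj G w a → Adj G w b
  good-pair-twin {b = b} {w = w} (ab , c , a~c , c~b , lines) line⊆I w≢b w~a =
    decidable-stable (T? (adj w b)) λ w≁b →
      twin-centre-far ab a~c c~b lines line⊆I w≢b w~a w≁b
        (twin-centre-adjacent a~c c~b lines w≢b w~a w≁b)

  good-pair-twins : GoodPair G a b → LineInInterval a b → w ≢ a → w ≢ b → Adj G w a ⇔ Adj G w b
  good-pair-twins gp line⊆I w≢a w≢b =
    mk⇔ (good-pair-twin gp line⊆I w≢b)
        (good-pair-twin (good-pair-sym gp) (line-in-interval-sym line⊆I) w≢a)

  interval-neighbours : Dist G a b 2 → Dist G p q 2 → (∀ z → Between G a b z → Between G p q z) →
                        w ≢ p → w ≢ q → Adj G w a → Adj G w b → Adj G w p × Adj G w q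
  interval-neighbours {w = w} ab pq I⊆I w≢p w≢q w~a w~b
    with between⇒common-neighbour pq (I⊆I w (common-neighbour⇒between ab (adj-symmetric w~a) w~b))
                                  (w≢p ∘ sym) w≢q
  ... | p~w , w~q = adj-symmetric p~w , w~q

  record InducedSquare (a b c d : V G) : Set where
    field
      a~b : Adj G a b
      b~c : Adj G b c
      c~d : Adj G c d
      d~a : Adj G d a
      ac  : Dist G a c 2
      bd  : Dist G b d 2

  -- A parallelogram whose diagonals have length 2 is an induced square:
  -- b ∈ I(a,c) and d ∈ I(c,a) are common neighbours of the diagonal ends.
  parallelogram-square : Parallelogram G a b c d → Dist G a c 2 → Dist G b d 2 →
                         InducedSquare a b c d
  parallelogram-square {a} {b} {c} {d} (a≢b , _ , a≢d , b≢c , _ , c≢d , abc , _ , cda , _) ac bd =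
    record { a~b = a~b ; b~c = b~c ; c~d = c~d ; d~a = d~a ; ac = ac ; bd = bd }
    where
    a~b×b~c : Adj G a b × Adj G b c
    a~b×b~c = between⇒common-neighbour ac abc a≢b b≢c
    c~d×d~a : Adj G c d × Adj G d a
    c~d×d~a = between⇒common-neighbour (dist-sym ac) cda c≢d (a≢d ∘ sym)
    a~b = proj₁ a~b×b~c
    b~c = proj₂ a~b×b~c
    c~d = proj₁ c~d×d~a
    d~a = proj₂ c~d×d~a

  corners : V G → V G → V G → V G → Fin 4 → V G
  corners a b c d zero = a
  corners a b c d (suc zero) = b
  corners a b c d (suc (suc zero)) = c
  corners a b c d (suc (suc (suc zero))) = d

  edge : ∀ {i j} {t : True (cycAdj? 4 i j)} → Adj G p q → Adj G p q ⇔ CycAdj 4 i j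
  edge {t = t} p~q = mk⇔ (λ _ → toWitness t) (λ _ → p~q)

  non-edge : ∀ {i j} {f : False (cycAdj? 4 i j)} → ¬ Adj G p q → Adj G p q ⇔ CycAdj 4 i j
  non-edge {f = f} p≁q = mk⇔ (⊥-elim ∘ p≁q) (⊥-elim ∘ toWitnessFalse f)

  square-induced : InducedSquare a b c d → InducedCopy G 4 (CycAdj 4) (corners a b c d)
  square-induced {a} {b} {c} {d} sq = injective , adjacency
    where
    open InducedSquare sq
    injective : ∀ {i j} → corners a b c d i ≡ corners a b c d j → i ≡ j
    injective {zero} {zero} _ = refl
    injective {zero} {suc zero} e = ⊥-elim (adj⇒≢ a~b e)
    injective {zero} {suc (suc zero)} e = ⊥-elim (dist2⇒≢ ac e)
    injective {zero} {suc (suc (suc zero))} e = ⊥-elim (adj⇒≢ d~a (sym e))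
    injective {suc zero} {zero} e = ⊥-elim (adj⇒≢ a~b (sym e))
    injective {suc zero} {suc zero} _ = refl
    injective {suc zero} {suc (suc zero)} e = ⊥-elim (adj⇒≢ b~c e)
    injective {suc zero} {suc (suc (suc zero))} e = ⊥-elim (dist2⇒≢ bd e)
    injective {suc (suc zero)} {zero} e = ⊥-elim (dist2⇒≢ ac (sym e))
    injective {suc (suc zero)} {suc zero} e = ⊥-elim (adj⇒≢ b~c (sym e))
    injective {suc (suc zero)} {suc (suc zero)} _ = refl
    injective {suc (suc zero)} {suc (suc (suc zero))} e = ⊥-elim (adj⇒≢ c~d e)
    injective {suc (suc (suc zero))} {zero} e = ⊥-elim (adj⇒≢ d~a e)
    injective {suc (suc (suc zero))} {suc zero} e = ⊥-elim (dist2⇒≢ bd (sym e))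
    injective {suc (suc (suc zero))} {suc (suc zero)} e = ⊥-elim (adj⇒≢ c~d (sym e))
    injective {suc (suc (suc zero))} {suc (suc (suc zero))} _ = refl

    adjacency : ∀ i j → Adj G (corners a b c d i) (corners a b c d j) ⇔ CycAdj 4 i j
    adjacency zero zero = non-edge (irrefl a)
    adjacency zero (suc zero) = edge a~b
    adjacency zero (suc (suc zero)) = non-edge (dist2⇒¬adj ac)
    adjacency zero (suc (suc (suc zero))) = edge (adj-symmetric d~a)
    adjacency (suc zero) zero = edge (adj-symmetric a~b)
    adjacency (suc zero) (suc zero) = non-edge (irrefl b)
    adjacency (suc zero) (suc (suc zero)) = edge b~c
    adjacency (suc zero) (suc (suc (suc zero))) = non-edge (dist2⇒¬adj bd)
    adjacency (suc (suc zero)) zero = non-edge (dist2⇒¬adj (dist-sym ac))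
    adjacency (suc (suc zero)) (suc zero) = edge (adj-symmetric b~c)
    adjacency (suc (suc zero)) (suc (suc zero)) = non-edge (irrefl c)
    adjacency (suc (suc zero)) (suc (suc (suc zero))) = edge c~d
    adjacency (suc (suc (suc zero))) zero = edge d~a
    adjacency (suc (suc (suc zero))) (suc zero) = non-edge (dist2⇒¬adj (dist-sym bd))
    adjacency (suc (suc (suc zero))) (suc (suc zero)) = edge (adj-symmetric c~d)
    adjacency (suc (suc (suc zero))) (suc (suc (suc zero))) = non-edge (irrefl d)

  four-elim : (P : V G → Set) → P u → P v → P x → P y → ∀ z → Four G u v x y z → P z
  four-elim P pu pv px py _ (inj₁ refl) = pu
  four-elim P pu pv px py _ (inj₂ (inj₁ refl)) = pv
  four-elim P pu pv px py _ (inj₂ (inj₂ (inj₁ refl))) = px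
  four-elim P pu pv px py _ (inj₂ (inj₂ (inj₂ refl))) = py

  SeesAllOrNone : (V G → Set) → Set
  SeesAllOrNone S = ∀ w → ¬ S w → (∀ s → S s → Adj G w s) ⊎ (∀ s → S s → ¬ Adj G w s)

  -- Module property for two good pairs u,v and x,y whose lines lie in their
  -- common interval I(u,v) = I(x,y): u,v are twins, x,y are twins, and a
  -- common neighbour of one pair lies in the interval, so it sees the other.
  twin-pairs-module : GoodPair G u v → GoodPair G x y → LineInInterval u v → LineInInterval x y →
                      SameSet G (Between G u v) (Between G x y) → SeesAllOrNone (Four G u v x y)
  twin-pairs-module {u} {v} {x} {y} gpUV gpXY uv⊆I xy⊆I intervals w w∉S =
    [ inj₁ ∘ sees-all , inj₂ ∘ sees-none ]′ (toSum (T? (adj w u)))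
    where
    w≢u : w ≢ u
    w≢u = w∉S ∘ inj₁
    w≢v : w ≢ v
    w≢v = w∉S ∘ inj₂ ∘ inj₁
    w≢x : w ≢ x
    w≢x = w∉S ∘ inj₂ ∘ inj₂ ∘ inj₁
    w≢y : w ≢ y
    w≢y = w∉S ∘ inj₂ ∘ inj₂ ∘ inj₂
    twinsUV : Adj G w u ⇔ Adj G w v
    twinsUV = good-pair-twins gpUV uv⊆I w≢u w≢v
    twinsXY : Adj G w x ⇔ Adj G w y
    twinsXY = good-pair-twins gpXY xy⊆I w≢x w≢y

    sees-all : Adj G w u → ∀ s → Four G u v x y s → Adj G w s
    sees-all w~u = four-elim (Adj G w) w~u w~v (proj₁ w~x×w~y) (proj₂ w~x×w~y)
      where
      w~v : Adj G w v
      w~v = Equivalence.to twinsUV w~u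
      w~x×w~y : Adj G w x × Adj G w y
      w~x×w~y = interval-neighbours (proj₁ gpUV) (proj₁ gpXY) (Equivalence.to ∘ intervals)
                                    w≢x w≢y w~u w~v

    sees-none : ¬ Adj G w u → ∀ s → Four G u v x y s → ¬ Adj G w s
    sees-none w≁u = four-elim (¬_ ∘ Adj G w) w≁u (w≁u ∘ Equivalence.from twinsUV) w≁x
                              (w≁x ∘ Equivalence.from twinsXY)
      where
      w≁x : ¬ Adj G w x
      w≁x w~x = w≁u (proj₁ (interval-neighbours (proj₁ gpXY) (proj₁ gpUV) (Equivalence.from ∘ intervals)
                                                  w≢u w≢v w~x (Equivalence.to twinsXY w~x)))

  square-C4Module : InducedSquare u x v y → SeesAllOrNone (Four G u v x y) → C4Module G (Four G u v x y)
  square-C4Module {u} {x} {v} {y} sq all-or-none =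
    (corners u x v y , square-induced sq , in-S , onto) , all-or-none
    where
    in-S : ∀ i → Four G u v x y (corners u x v y i)
    in-S zero = inj₁ refl
    in-S (suc zero) = inj₂ (inj₂ (inj₁ refl))
    in-S (suc (suc zero)) = inj₂ (inj₁ refl)
    in-S (suc (suc (suc zero))) = inj₂ (inj₂ (inj₂ refl))
    onto : ∀ z → Four G u v x y z → ∃ λ i → corners u x v y i ≡ z
    onto = four-elim (λ z → ∃ λ i → corners u x v y i ≡ z)
                     (zero , refl) (suc (suc zero) , refl) (suc zero , refl) (suc (suc (suc zero)) , refl)

proposition2 : (G : Graph) → Connected G → ¬ HasInducedHouse G → ¬ HasInducedHole G →
    ∀ u v x y → GoodPair G u v → GoodPair G x y →
    SameSet G (Line G u v) (Line G x y) →
    γRelated G u v x y →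
    C4Module G (Four G u v x y)
proposition2 G _ _ _ u v x y gpUV gpXY _ (parallelogram , line=I[u,v] , I[u,v]=I[x,y] , I[x,y]=line) =
  square-C4Module G (parallelogram-square G parallelogram (proj₁ gpUV) (proj₁ gpXY))
    (twin-pairs-module G gpUV gpXY uv⊆I xy⊆I I[u,v]=I[x,y])
  where
  uv⊆I : LineInInterval G u v
  uv⊆I z = Equivalence.to (line=I[u,v] z)
  xy⊆I : LineInInterval G x y
  xy⊆I z = Equivalence.from (I[x,y]=line z)
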